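{- Let $\lambda_1,\dots,\lambda_n$ be pairwise coprime positive integers. For every positive integer $s$, there exists at most one element $q\in\overline{Q}(\lambda)$ with $\sigma_\lambda(q)=s$ and $q_i<\lambda_i$ for every $1\le i\le n$.
   Context: $Q(\lambda)\subset\mathbb{Z}^{n+1}$ is the affine semigroup generated by all points $(p,1)$ with $p\in\mathbb{Z}^n$ lying in the simplex with vertices $0,\lambda_1e_1,\dots,\lambda_ne_n$; $\overline{Q}(\lambda)=\mathbb{Z}^{n+1}\cap\mathbb{R}_{\ge0}Q(\lambda)$ is its normalization. $\sigma_\lambda(z)=Lz_{n+1}-\sum_{i=1}^n\frac{L}{\lambda_i}z_i$ with $L=\operatorname{lcm}(\lambda_1,\dots,\lambda_n)$, and $q_i$ denotes the $i$-th coordinate of $q$. -}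

module Defs where

open import Data.Nat as ℕ using (ℕ; zero; suc)
open import Data.Nat.LCM using (lcm)
open import Data.Nat.Coprimality using (Coprime)
open import Data.Integer as ℤ using (ℤ; +_)
open import Data.Rational as ℚ using (ℚ; 0ℚ; 1ℚ)
open import Data.Fin as Fin using (Fin)
open import Data.List using (List; []; _∷_)
open import Data.List.Relation.Unary.All using (All)
open import Data.Product using (Σ; _×_; _,_; proj₁; proj₂)
open import Relation.Binary.PropositionalEquality using (_≡_; _≢_)

-- Points of ℤ^{n+1}: the coordinates z_1..z_n as a function Fin n → ℤ
-- (z_i is  proj₁ z i,  with i : Fin n standing for 1 ≤ i ≤ n),
-- together with the last coordinate z_{n+1} = proj₂ z.
Point : ℕ → Set
Point n = (Fin n → ℤ) × ℤ

sumℤ : ∀ {n} → (Fin n → ℤ) → ℤ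
sumℤ {zero}  f = + 0
sumℤ {suc n} f = f Fin.zero ℤ.+ sumℤ (λ i → f (Fin.suc i))

sumℚ : ∀ {n} → (Fin n → ℚ) → ℚ
sumℚ {zero}  f = 0ℚ
sumℚ {suc n} f = f Fin.zero ℚ.+ sumℚ (λ i → f (Fin.suc i))

lcmAll : ∀ {n} → (Fin n → ℕ) → ℕ
lcmAll {zero}  λ′ = 1
lcmAll {suc n} λ′ = lcm (λ′ Fin.zero) (lcmAll (λ i → λ′ (Fin.suc i)))

-- Natural division m / d, total (returns 0 when d = 0; only used with d > 0).
divℕ : ℕ → ℕ → ℕ
divℕ m zero    = 0
divℕ m (suc d) = m ℕ./ suc d

-- Rational number a / d, total (returns 0 when d = 0; only used with d > 0).
_/ℕ_ : ℤ → ℕ → ℚ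
a /ℕ zero  = 0ℚ
a /ℕ suc d = a ℚ./ suc d

PairwiseCoprimePos : ∀ {n} → (Fin n → ℕ) → Set
PairwiseCoprimePos λ′ = (∀ i → 0 ℕ.< λ′ i) × (∀ i j → i ≢ j → Coprime (λ′ i) (λ′ j))

-- p ∈ ℤ^n lies in the simplex with vertices 0, λ_1 e_1, …, λ_n e_n,
-- i.e. p_i ≥ 0 for all i and Σ_i p_i / λ_i ≤ 1.
InSimplex : ∀ {n} → (Fin n → ℕ) → (Fin n → ℤ) → Set
InSimplex λ′ p = (∀ i → + 0 ℤ.≤ p i) × (sumℚ (λ i → p i /ℕ λ′ i) ℚ.≤ 1ℚ)

IsGen : ∀ {n} → (Fin n → ℕ) → Point n → Set
IsGen λ′ (p , h) = InSimplex λ′ p × h ≡ + 1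

_⊕_ : ∀ {n} → Point n → Point n → Point n
(a , a₀) ⊕ (b , b₀) = (λ i → a i ℤ.+ b i) , (a₀ ℤ.+ b₀)

zeroPt : ∀ {n} → Point n
zeroPt = (λ _ → + 0) , + 0

sumPts : ∀ {n} → List (Point n) → Point n
sumPts []       = zeroPt
sumPts (x ∷ xs) = x ⊕ sumPts xs

-- Q(λ): the affine semigroup generated by the generators, i.e. all finite
-- sums of generators (the empty sum 0 included).
InQ : ∀ {n} → (Fin n → ℕ) → Point n → Set
InQ λ′ z = Σ (List (Point _)) λ gs → All (IsGen λ′) gs × sumPts gs ≡ z

combo : ∀ {n} → List (ℚ × Point n) → (Fin n → ℚ) × ℚ
combo []             = (λ _ → 0ℚ) , 0ℚ
combo ((c , (q , h)) ∷ xs) =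
  (λ i → c ℚ.* (q i ℚ./ 1) ℚ.+ proj₁ (combo xs) i) , (c ℚ.* (h ℚ./ 1) ℚ.+ proj₂ (combo xs))

InQbar : ∀ {n} → (Fin n → ℕ) → Point n → Set
InQbar λ′ (z , z₀) =
  Σ (List (ℚ × Point _)) λ cs →
    All (λ { (c , q) → (0ℚ ℚ.≤ c) × InQ λ′ q }) cs ×
    ((∀ i → proj₁ (combo cs) i ≡ z i ℚ./ 1) × proj₂ (combo cs) ≡ z₀ ℚ./ 1)

σ : ∀ {n} → (Fin n → ℕ) → Point n → ℤ
σ λ′ (z , z₀) =
  (+ lcmAll λ′) ℤ.* z₀ ℤ.- sumℤ (λ i → (+ divℕ (lcmAll λ′) (λ′ i)) ℤ.* z i)

{-# OPTIONS --safe #-}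
-- For pairwise coprime λ, L = lcm = ∏ λᵢ and the weights L/λᵢ are the cofactors ∏_{k≠i} λₖ.
-- Two points q, q′ with σ(q) = σ(q′) satisfy L (q₀ − q₀′) = Σᵢ (L/λᵢ)(qᵢ − qᵢ′).  Modulo λⱼ
-- every term except the j-th vanishes and L/λⱼ is a unit, so λⱼ ∣ qⱼ − qⱼ′; since points of
-- Q̄(λ) have nonnegative coordinates and both lie below λⱼ, qⱼ = qⱼ′.  Then L (q₀ − q₀′) = 0.
module Submission where

open import Defs
open import Data.Nat using (ℕ; zero; suc; NonZero)
import Data.Nat as ℕ
import Data.Nat.Properties as ℕ
open import Data.Nat.Divisibility as ℕ using (divides; ∣-trans; m∣m*n; n∣m*n; ∣1⇒≡1; >⇒∤)
open import Data.Nat.DivMod using (m*n/n≡m)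
open import Data.Nat.Coprimality using (Coprime; coprime-divisor; coprime⇒gcd≡1)
open import Data.Nat.GCD using (gcd)
open import Data.Nat.LCM using (lcm; gcd*lcm)
open import Data.Integer as ℤ using (ℤ; +_; _<_; _+_; _-_; _*_; ∣_∣)
import Data.Integer.Properties as ℤ
open import Data.Integer.Divisibility.Signed as ℤ∣
  using (∣ᵤ⇒∣; ∣⇒∣ᵤ; ∣m∣n⇒∣m+n; ∣m+n∣m⇒∣n; ∣m+n∣n⇒∣m; ∣m⇒∣m*n)
open import Data.Integer.Tactic.RingSolver using (solve-∀)
open import Data.Rational as ℚ using (ℚ; 0ℚ)
import Data.Rational.Properties as ℚ
open import Data.Fin using (Fin) renaming (zero to fzero; suc to fsuc)
open import Data.Fin.Properties using (0≢1+n; suc-injective)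
open import Data.List using (List; []; _∷_)
open import Data.List.Relation.Unary.All using (All; []; _∷_)
open import Data.Product using (_×_; _,_; proj₁; proj₂)
open import Relation.Binary.PropositionalEquality
open import Data.Empty using (⊥-elim)
open import Function.Base using (_∘′_)

private
  variable
    n : ℕ

PairwiseCoprime : (Fin n → ℕ) → Set
PairwiseCoprime f = ∀ i j → i ≢ j → Coprime (f i) (f j)

PairwiseCoprime-tail : {f : Fin (suc n) → ℕ} → PairwiseCoprime f → PairwiseCoprime (λ i → f (fsuc i))
PairwiseCoprime-tail cop i j i≢j = cop (fsuc i) (fsuc j) (λ e → i≢j (suc-injective e))

∏ : (Fin n → ℕ) → ℕ
∏ {zero}  f = 1
∏ {suc n} f = f fzero ℕ.* ∏ (λ i → f (fsuc i))

∏-except : Fin n → (Fin n → ℕ) → ℕ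
∏-except fzero    f = ∏ (λ i → f (fsuc i))
∏-except (fsuc j) f = f fzero ℕ.* ∏-except j (λ i → f (fsuc i))

∏-except-*≡∏ : (j : Fin n) (f : Fin n → ℕ) → ∏-except j f ℕ.* f j ≡ ∏ f
∏-except-*≡∏ fzero    f = ℕ.*-comm (∏ (λ i → f (fsuc i))) (f fzero)
∏-except-*≡∏ (fsuc j) f = trans (ℕ.*-assoc (f fzero) _ _)
  (cong (f fzero ℕ.*_) (∏-except-*≡∏ j (λ i → f (fsuc i))))

∣∏ : (j : Fin n) (f : Fin n → ℕ) → f j ℕ.∣ ∏ f
∣∏ j f = divides (∏-except j f) (sym (∏-except-*≡∏ j f))

∣∏-except : (i j : Fin n) (f : Fin n → ℕ) → i ≢ j → f i ℕ.∣ ∏-except j f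
∣∏-except fzero    fzero    f i≢j = ⊥-elim (i≢j refl)
∣∏-except fzero    (fsuc j) f i≢j = m∣m*n _
∣∏-except (fsuc i) fzero    f i≢j = ∣∏ i (λ k → f (fsuc k))
∣∏-except (fsuc i) (fsuc j) f i≢j =
  ∣-trans (∣∏-except i j (λ k → f (fsuc k)) (λ e → i≢j (cong fsuc e))) (n∣m*n (f fzero))

∏-nonZero : (f : Fin n → ℕ) → (∀ i → NonZero (f i)) → NonZero (∏ f)
∏-nonZero {zero}  f f≢0 = _
∏-nonZero {suc n} f f≢0 =
  ℕ.m*n≢0 (f fzero) (∏ (λ i → f (fsuc i))) {{f≢0 fzero}} {{∏-nonZero _ (λ i → f≢0 (fsuc i))}}

coprime-* : ∀ {a b c} → Coprime a b → Coprime a c → Coprime a (b ℕ.* c)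
coprime-* {a} {b} a⊥b a⊥c {d} (d∣a , d∣bc) = a⊥c (d∣a , coprime-divisor d⊥b d∣bc)
  where
  d⊥b : Coprime d b
  d⊥b (e∣d , e∣b) = a⊥b (∣-trans e∣d d∣a , e∣b)

coprime-∏ : ∀ {a} (f : Fin n → ℕ) → (∀ i → Coprime a (f i)) → Coprime a (∏ f)
coprime-∏ {zero}  f a⊥f (_ , d∣1) = ∣1⇒≡1 d∣1
coprime-∏ {suc n} f a⊥f = coprime-* (a⊥f fzero) (coprime-∏ _ (λ i → a⊥f (fsuc i)))

coprime-∏-except : (j : Fin n) (f : Fin n → ℕ) → PairwiseCoprime f → Coprime (f j) (∏-except j f)
coprime-∏-except fzero    f cop = coprime-∏ _ (λ i → cop fzero (fsuc i) 0≢1+n)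
coprime-∏-except (fsuc j) f cop =
  coprime-* (cop (fsuc j) fzero (0≢1+n ∘′ sym)) (coprime-∏-except j _ (PairwiseCoprime-tail cop))

lcmAll≡∏ : (f : Fin n → ℕ) → PairwiseCoprime f → lcmAll f ≡ ∏ f
lcmAll≡∏ {zero}  f cop = refl
lcmAll≡∏ {suc n} f cop = begin
  lcm a (lcmAll f′)             ≡⟨ cong (lcm a) (lcmAll≡∏ f′ (PairwiseCoprime-tail cop)) ⟩
  lcm a (∏ f′)                  ≡⟨ ℕ.*-identityˡ _ ⟨
  1 ℕ.* lcm a (∏ f′)            ≡⟨ cong (ℕ._* lcm a (∏ f′)) gcd≡1 ⟨
  gcd a (∏ f′) ℕ.* lcm a (∏ f′) ≡⟨ gcd*lcm a (∏ f′) ⟩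
  a ℕ.* ∏ f′                    ∎
  where
  open ≡-Reasoning
  a = f fzero
  f′ = λ i → f (fsuc i)
  gcd≡1 : gcd a (∏ f′) ≡ 1
  gcd≡1 = coprime⇒gcd≡1 (coprime-∏ f′ (λ i → cop fzero (fsuc i) 0≢1+n))

divℕ-*ˡ : ∀ m {d} → 0 ℕ.< d → divℕ (m ℕ.* d) d ≡ m
divℕ-*ˡ m {suc d} _ = m*n/n≡m m (suc d)

lcmAll/≡∏-except : (j : Fin n) (f : Fin n → ℕ) → 0 ℕ.< f j → PairwiseCoprime f →
                   divℕ (lcmAll f) (f j) ≡ ∏-except j f
lcmAll/≡∏-except j f 0<fj cop rewrite lcmAll≡∏ f cop | sym (∏-except-*≡∏ j f) =
  divℕ-*ˡ (∏-except j f) 0<fj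

sumℤ-zero : (f : Fin n → ℤ) → (∀ i → f i ≡ + 0) → sumℤ f ≡ + 0
sumℤ-zero {zero}  f f≡0 = refl
sumℤ-zero {suc n} f f≡0 = cong₂ _+_ (f≡0 fzero) (sumℤ-zero _ (λ i → f≡0 (fsuc i)))

sumℤ-*-sub : (c x y : Fin n → ℤ) →
  sumℤ (λ i → c i * x i) - sumℤ (λ i → c i * y i) ≡ sumℤ (λ i → c i * (x i - y i))
sumℤ-*-sub {zero}  c x y = refl
sumℤ-*-sub {suc n} c x y =
  trans (step (c fzero) (x fzero) (y fzero) _ _)
        (cong (_+_ (c fzero * (x fzero - y fzero)))
              (sumℤ-*-sub (λ i → c (fsuc i)) (λ i → x (fsuc i)) (λ i → y (fsuc i))))
  where
  step : ∀ c x y S T → (c * x + S) - (c * y + T) ≡ c * (x - y) + (S - T)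
  step = solve-∀

∣sumℤ : ∀ {k} (f : Fin n → ℤ) → (∀ i → k ℤ∣.∣ f i) → k ℤ∣.∣ sumℤ f
∣sumℤ {zero}  f k∣f = ∣ᵤ⇒∣ (_ ℕ.∣0)
∣sumℤ {suc n} f k∣f = ∣m∣n⇒∣m+n (k∣f fzero) (∣sumℤ _ (λ i → k∣f (fsuc i)))

∣sumℤ⇒∣term : ∀ {k} (f : Fin n → ℤ) (j : Fin n) →
  k ℤ∣.∣ sumℤ f → (∀ i → i ≢ j → k ℤ∣.∣ f i) → k ℤ∣.∣ f j
∣sumℤ⇒∣term f fzero    k∣Σ k∣f = ∣m+n∣n⇒∣m k∣Σ (∣sumℤ _ (λ i → k∣f (fsuc i) (0≢1+n ∘′ sym)))
∣sumℤ⇒∣term f (fsuc j) k∣Σ k∣f =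
  ∣sumℤ⇒∣term _ j (∣m+n∣m⇒∣n k∣Σ (k∣f fzero 0≢1+n)) (λ i i≢j → k∣f (fsuc i) (i≢j ∘′ suc-injective))

coprime-divisorℤ : ∀ {k c d} → Coprime k ∣ c ∣ → + k ℤ∣.∣ c * d → + k ℤ∣.∣ d
coprime-divisorℤ {k} {c} {d} k⊥c k∣cd =
  ∣ᵤ⇒∣ (coprime-divisor k⊥c (subst (k ℕ.∣_) (ℤ.abs-* c d) (∣⇒∣ᵤ k∣cd)))

l∣i-j⇒i≡j : ∀ {l i j} → + 0 ℤ.≤ i → + 0 ℤ.≤ j → i < + l → j < + l → + l ℤ∣.∣ i - j → i ≡ j
l∣i-j⇒i≡j {l} {+ a} {+ b} _ _ (ℤ.+<+ a<l) (ℤ.+<+ b<l) l∣a-b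
  with ∣ a ℤ.⊖ b ∣ in ∣a⊖b∣≡
... | zero  = ℤ.i-j≡0⇒i≡j (+ a) (+ b) (trans (ℤ.m-n≡m⊖n a b) (ℤ.∣i∣≡0⇒i≡0 ∣a⊖b∣≡))
... | suc k = ⊥-elim (>⇒∤ k<l (subst (l ℕ.∣_) ∣a-b∣≡ (∣⇒∣ᵤ l∣a-b)))
  where
  ∣a-b∣≡ : ∣ + a - + b ∣ ≡ suc k
  ∣a-b∣≡ = trans (cong ∣_∣ (ℤ.m-n≡m⊖n a b)) ∣a⊖b∣≡
  k<l : suc k ℕ.< l
  k<l = subst (ℕ._< l) ∣a⊖b∣≡ (ℕ.≤-<-trans (ℤ.∣m⊝n∣≤m⊔n a b) (ℕ.⊔-lub a<l b<l))

0≤i⇒0≤i/1 : ∀ i → + 0 ℤ.≤ i → 0ℚ ℚ.≤ i ℚ./ 1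
0≤i⇒0≤i/1 (+ m) _ = ℚ.nonNegative⁻¹ _ {{ℚ.normalize-nonNeg m 1}}

0≤i/1⇒0≤i : ∀ i → 0ℚ ℚ.≤ i ℚ./ 1 → + 0 ℤ.≤ i
0≤i/1⇒0≤i (+ m)       _ = ℤ.+≤+ ℕ.z≤n
0≤i/1⇒0≤i ℤ.-[1+ m ] 0≤i = ⊥-elim (ℚ.<-irrefl refl (ℚ.<-≤-trans i<0 0≤i))
  where
  i<0 : ℤ.-[1+ m ] ℚ./ 1 ℚ.< 0ℚ
  i<0 = ℚ.negative⁻¹ _ {{ℚ.neg-pos {ℚ.normalize (suc m) 1} (ℚ.normalize-pos (suc m) 1)}}

0≤p*q : ∀ {p q} → 0ℚ ℚ.≤ p → 0ℚ ℚ.≤ q → 0ℚ ℚ.≤ p ℚ.* q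
0≤p*q {p} {q} 0≤p 0≤q =
  ℚ.nonNegative⁻¹ _ {{ℚ.nonNeg*nonNeg⇒nonNeg p {{ℚ.nonNegative 0≤p}} q {{ℚ.nonNegative 0≤q}}}}

module _ {λ′ : Fin n → ℕ} where

  sumPts-nonNeg : (gs : List (Point n)) → All (IsGen λ′) gs → ∀ i → + 0 ℤ.≤ proj₁ (sumPts gs) i
  sumPts-nonNeg []       []                       i = ℤ.≤-refl
  sumPts-nonNeg (_ ∷ gs) (((p≥0 , _) , _) ∷ gens) i =
    ℤ.+-mono-≤ (p≥0 i) (sumPts-nonNeg gs gens i)

  InQ-nonNeg : (q : Point n) → InQ λ′ q → ∀ i → + 0 ℤ.≤ proj₁ q i
  InQ-nonNeg q (gs , gens , refl) = sumPts-nonNeg gs gens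

  combo-nonNeg : (cs : List (ℚ × Point n)) →
    All (λ { (c , q) → (0ℚ ℚ.≤ c) × InQ λ′ q }) cs → ∀ i → 0ℚ ℚ.≤ proj₁ (combo cs) i
  combo-nonNeg []             []                   i = ℚ.≤-refl
  combo-nonNeg ((c , q) ∷ cs) ((c≥0 , q∈Q) ∷ cs-ok) i =
    ℚ.+-mono-≤ (0≤p*q c≥0 (0≤i⇒0≤i/1 _ (InQ-nonNeg q q∈Q i))) (combo-nonNeg cs cs-ok i)

  InQbar-nonNeg : (q : Point n) → InQbar λ′ q → ∀ i → + 0 ℤ.≤ proj₁ q i
  InQbar-nonNeg (z , _) (cs , cs-ok , z≡combo , _) i =
    0≤i/1⇒0≤i (z i) (subst (0ℚ ℚ.≤_) (z≡combo i) (combo-nonNeg cs cs-ok i))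

weight : (Fin n → ℕ) → Fin n → ℤ
weight λ′ i = + divℕ (lcmAll λ′) (λ′ i)

a-c≡b-d⇒a-b≡c-d : ∀ a b c d → a - c ≡ b - d → a - b ≡ c - d
a-c≡b-d⇒a-b≡c-d a b c d a-c≡b-d = begin
  a - b                         ≡⟨ regroup a b c d ⟩
  (a - c) - (b - d) + (c - d)   ≡⟨ cong (λ u → u - (b - d) + (c - d)) a-c≡b-d ⟩
  (b - d) - (b - d) + (c - d)   ≡⟨ cancel (b - d) (c - d) ⟩
  c - d                         ∎
  where
  open ≡-Reasoning
  regroup : ∀ a b c d → a - b ≡ (a - c) - (b - d) + (c - d)
  regroup = solve-∀
  cancel : ∀ u v → u - u + v ≡ v
  cancel = solve-∀

σ≡σ⇒balance : (λ′ : Fin n → ℕ) (z z′ : Fin n → ℤ) (z₀ z₀′ : ℤ) → σ λ′ (z , z₀) ≡ σ λ′ (z′ , z₀′) →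
              + lcmAll λ′ * (z₀ - z₀′) ≡ sumℤ (λ i → weight λ′ i * (z i - z′ i))
σ≡σ⇒balance λ′ z z′ z₀ z₀′ σ≡σ = begin
  L * (z₀ - z₀′)                                        ≡⟨ distrib L z₀ z₀′ ⟩
  L * z₀ - L * z₀′                                      ≡⟨ a-c≡b-d⇒a-b≡c-d (L * z₀) (L * z₀′) _ _ σ≡σ ⟩
  sumℤ (λ i → w i * z i) - sumℤ (λ i → w i * z′ i)     ≡⟨ sumℤ-*-sub w z z′ ⟩
  sumℤ (λ i → w i * (z i - z′ i))                       ∎
  where
  open ≡-Reasoning
  L = + lcmAll λ′
  w = weight λ′
  distrib : ∀ a x y → a * (x - y) ≡ a * x - a * y
  distrib = solve-∀

balance⇒λⱼ∣dⱼ : (λ′ : Fin n → ℕ) → PairwiseCoprimePos λ′ → (d₀ : ℤ) (d : Fin n → ℤ) →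
                + lcmAll λ′ * d₀ ≡ sumℤ (λ i → weight λ′ i * d i) → ∀ j → + λ′ j ℤ∣.∣ d j
balance⇒λⱼ∣dⱼ λ′ (λ>0 , cop) d₀ d balance j =
  coprime-divisorℤ {c = weight λ′ j} λⱼ⊥wⱼ (∣sumℤ⇒∣term _ j λⱼ∣Σ λⱼ∣wᵢdᵢ)
  where
  w≡∏-except : ∀ i → divℕ (lcmAll λ′) (λ′ i) ≡ ∏-except i λ′
  w≡∏-except i = lcmAll/≡∏-except i λ′ (λ>0 i) cop
  λⱼ⊥wⱼ : Coprime (λ′ j) (divℕ (lcmAll λ′) (λ′ j))
  λⱼ⊥wⱼ = subst (Coprime (λ′ j)) (sym (w≡∏-except j)) (coprime-∏-except j λ′ cop)
  λⱼ∣L : + λ′ j ℤ∣.∣ + lcmAll λ′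
  λⱼ∣L = ∣ᵤ⇒∣ (subst (λ′ j ℕ.∣_) (sym (lcmAll≡∏ λ′ cop)) (∣∏ j λ′))
  λⱼ∣Σ : + λ′ j ℤ∣.∣ sumℤ (λ i → weight λ′ i * d i)
  λⱼ∣Σ = subst (+ λ′ j ℤ∣.∣_) balance (∣m⇒∣m*n d₀ λⱼ∣L)
  λⱼ∣wᵢdᵢ : ∀ i → i ≢ j → + λ′ j ℤ∣.∣ weight λ′ i * d i
  λⱼ∣wᵢdᵢ i i≢j = ∣m⇒∣m*n {m = weight λ′ i} (d i)
    (∣ᵤ⇒∣ (subst (λ′ j ℕ.∣_) (sym (w≡∏-except i)) (∣∏-except j i λ′ (i≢j ∘′ sym))))

lcmAll-nonZero : (λ′ : Fin n → ℕ) → PairwiseCoprimePos λ′ → NonZero (lcmAll λ′)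
lcmAll-nonZero λ′ (λ>0 , cop) =
  subst NonZero (sym (lcmAll≡∏ λ′ cop)) (∏-nonZero λ′ (λ i → ℕ.>-nonZero (λ>0 i)))

lemma4p5 : (n : ℕ) (λ′ : Fin n → ℕ) → PairwiseCoprimePos λ′ →
    (s : ℕ) → 0 Data.Nat.< s →
    (q q′ : Point n) →
    InQbar λ′ q → σ λ′ q ≡ + s → (∀ i → proj₁ q i < + λ′ i) →
    InQbar λ′ q′ → σ λ′ q′ ≡ + s → (∀ i → proj₁ q′ i < + λ′ i) →
    (∀ i → proj₁ q i ≡ proj₁ q′ i) × proj₂ q ≡ proj₂ q′
lemma4p5 n λ′ λ-ok _ _ (z , z₀) (z′ , z₀′) q∈Q̄ σq≡s q<λ q′∈Q̄ σq′≡s q′<λ = z≡z′ , z₀≡z₀′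
  where
  balance : + lcmAll λ′ * (z₀ - z₀′) ≡ sumℤ (λ i → weight λ′ i * (z i - z′ i))
  balance = σ≡σ⇒balance λ′ z z′ z₀ z₀′ (trans σq≡s (sym σq′≡s))
  z≡z′ : ∀ i → z i ≡ z′ i
  z≡z′ i = l∣i-j⇒i≡j (InQbar-nonNeg {λ′ = λ′} (z , z₀) q∈Q̄ i) (InQbar-nonNeg {λ′ = λ′} (z′ , z₀′) q′∈Q̄ i)
                     (q<λ i) (q′<λ i) (balance⇒λⱼ∣dⱼ λ′ λ-ok _ _ balance i)
  wᵢdᵢ≡0 : ∀ i → weight λ′ i * (z i - z′ i) ≡ + 0
  wᵢdᵢ≡0 i = trans (cong (weight λ′ i *_) (ℤ.i≡j⇒i-j≡0 (z≡z′ i))) (ℤ.*-zeroʳ (weight λ′ i))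
  L·d₀≡0 : + lcmAll λ′ * (z₀ - z₀′) ≡ + lcmAll λ′ * + 0
  L·d₀≡0 = trans balance (trans (sumℤ-zero _ wᵢdᵢ≡0) (sym (ℤ.*-zeroʳ (+ lcmAll λ′))))
  z₀≡z₀′ : z₀ ≡ z₀′
  z₀≡z₀′ = ℤ.i-j≡0⇒i≡j z₀ z₀′ (ℤ.*-cancelˡ-≡ (+ lcmAll λ′) _ _ {{lcmAll-nonZero λ′ λ-ok}} L·d₀≡0)
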